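{- Let $G$ be a graph with $\alpha(G)=2$ and let $H=\overline G$. Then $G$ is $\alpha$-critical and $G\in\mathbf W_p$ if and only if $H$ is maximal triangle-free and $\delta(H)\ge p$. In this case $\operatorname{w}(G)=\delta(H)$.
   Context: All graphs are finite, simple and non-empty; $p\ge1$ is an integer. $\alpha(G)$ is the independence number. $G\in\mathbf W_p$ means: $|V(G)|\ge p$ and any $p$ pairwise disjoint independent sets $A_1,\dots,A_p$ extend to pairwise disjoint maximum independent sets $M_i\supseteq A_i$. An edge $e$ is $\alpha$-critical if $\alpha(G-e)>\alpha(G)$; $G$ is $\alpha$-critical if all edges are. $H$ is maximal triangle-free if it has no triangle and adding any non-edge creates a triangle. $\delta(H)$ is the minimum degree. For well-covered $G$ (all maximal independent sets of size $\alpha(G)$), $\operatorname{w}(G)=\max\{p\ge1:G\in\mathbf W_p\}$. -}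

module Defs where

open import Data.Nat using (ℕ; zero; suc; _≤_; _<_; _⊓_)
open import Data.Bool using (Bool; true; false; not; _∧_; _∨_; if_then_else_)
open import Data.Fin using (Fin; _≟_)
open import Data.Fin.Subset using (Subset; _∈_; _⊆_; ∣_∣)
open import Data.List using (List; foldr; map)
open import Data.Nat.ListAction using (sum)
open import Data.List.Base using (allFin)
open import Data.Product using (Σ; ∃; _×_; _,_)
open import Data.Empty using (⊥)
open import Relation.Nullary using (¬_)
open import Relation.Nullary.Decidable using (⌊_⌋)
open import Relation.Binary.PropositionalEquality using (_≡_; _≢_)

Adj : ℕ → Set
Adj n = Fin n → Fin n → Bool

record Graph (n : ℕ) : Set where
  field
    adj    : Adj n
    sym    : ∀ u v → adj u v ≡ adj v u
    irrefl : ∀ v → adj v v ≡ false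
open Graph public

compl : ∀ {n} → Adj n → Adj n
compl A u v = if ⌊ u ≟ v ⌋ then false else not (A u v)

deleteEdge : ∀ {n} → Adj n → Fin n → Fin n → Adj n
deleteEdge A a b u v =
  if (⌊ u ≟ a ⌋ ∧ ⌊ v ≟ b ⌋) ∨ (⌊ u ≟ b ⌋ ∧ ⌊ v ≟ a ⌋) then false else A u v

Independent : ∀ {n} → Adj n → Subset n → Set
Independent A S = ∀ u v → u ∈ S → v ∈ S → A u v ≡ false

IsAlpha : ∀ {n} → Adj n → ℕ → Set
IsAlpha A k = (Σ _ λ S → Independent A S × ∣ S ∣ ≡ k)
            × (∀ S → Independent A S → ∣ S ∣ ≤ k)

MaximumIndependent : ∀ {n} → Adj n → Subset n → Set
MaximumIndependent A M = Independent A M × (∀ S → Independent A S → ∣ S ∣ ≤ ∣ M ∣)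

MaximalIndependent : ∀ {n} → Adj n → Subset n → Set
MaximalIndependent A M = Independent A M × (∀ S → Independent A S → M ⊆ S → S ⊆ M)

WellCovered : ∀ {n} → Adj n → Set
WellCovered A = ∀ M → MaximalIndependent A M → MaximumIndependent A M

AlphaCriticalEdge : ∀ {n} → Adj n → Fin n → Fin n → Set
AlphaCriticalEdge A a b = ∀ k l → IsAlpha A k → IsAlpha (deleteEdge A a b) l → k < l

AlphaCritical : ∀ {n} → Adj n → Set
AlphaCritical A = ∀ a b → A a b ≡ true → AlphaCriticalEdge A a b

Disjoint : ∀ {n} → Subset n → Subset n → Set
Disjoint S T = ∀ x → x ∈ S → x ∈ T → ⊥

W : ∀ {n} → Adj n → ℕ → Set
W {n} A p = p ≤ n ×
  ((As : Fin p → Subset n) → (∀ i → Independent A (As i)) →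
   (∀ i j → i ≢ j → Disjoint (As i) (As j)) →
   Σ (Fin p → Subset n) λ Ms →
     (∀ i → MaximumIndependent A (Ms i)) ×
     (∀ i j → i ≢ j → Disjoint (Ms i) (Ms j)) ×
     (∀ i → As i ⊆ Ms i))

IsW : ∀ {n} → Adj n → ℕ → Set
IsW A w = 1 ≤ w × W A w × (∀ q → 1 ≤ q → W A q → q ≤ w)

TriangleFree : ∀ {n} → Adj n → Set
TriangleFree A = ∀ u v w → A u v ≡ true → A v w ≡ true → A u w ≡ true → ⊥

MaximalTriangleFree : ∀ {n} → Adj n → Set
MaximalTriangleFree A = TriangleFree A ×
  (∀ u v → u ≢ v → A u v ≡ false → ∃ λ w → A u w ≡ true × A w v ≡ true)

degree : ∀ {n} → Adj n → Fin n → ℕ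
degree {n} A v = sum (map (λ u → if A v u then 1 else 0) (allFin n))

minDegree : ∀ {m} → Adj (suc m) → ℕ
minDegree {m} A = foldr _⊓_ (degree A Fin.zero) (map (degree A) (allFin (suc m)))

-- With α(G) = 2 the independent sets of G are exactly the cliques of size at most 2 of
-- H = Ḡ, so H is triangle-free and the maximum independent sets of G are the edges of H.
-- Deleting an edge ab of G raises α exactly when a and b have a common neighbour in H,
-- which is the maximality of H among triangle-free graphs.
-- If δ(H) ≥ p, disjoint independent sets A₁ … A_p are grown one at a time into disjoint
-- edges of H: every other Aⱼ is a clique of the triangle-free H, so it meets the
-- H-neighbourhood of a vertex (of size ≥ p) in at most one vertex, and a neighbour outside
-- all of them remains. Conversely the deg_H(v) + 1 sets {v} and {u}, u ∈ N_H(v), do not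
-- extend: the class of v must contain a second vertex, an H-neighbour of v already used
-- by another class. Hence w(G) = δ(H); and since H has no isolated vertex, every maximal
-- independent set of G contains an edge of H, so G is well-covered.

module Submission where

open import Defs

open import Data.Bool using (Bool; true; false; not; _∧_; _∨_; if_then_else_)
import Data.Bool as Bool
open import Data.Bool.Properties using (∧-comm; ∨-comm; ∧-zeroʳ)
open import Data.Empty using (⊥-elim)
open import Data.Fin using (Fin; zero; suc; _≟_; _↑ˡ_; splitAt; join; punchIn; punchOut)
import Data.Fin.Properties as Fin
open import Data.Fin.Subset
  using (Subset; _∈_; _∉_; _⊆_; ∣_∣; ⁅_⁆; ⊥; _∪_; _∩_; _─_; inside; outside)
open import Data.Fin.Subset.Properties
open import Data.List as List using (List; foldr; map; allFin)
import Data.List.Membership.Propositional as List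
open import Data.List.Membership.Propositional.Properties using (∈-map⁺; ∈-map⁻; ∈-allFin)
open import Data.List.Properties using (map-tabulate)
open import Data.List.Relation.Unary.All as All using (All; []; _∷_)
open import Data.List.Relation.Unary.Any using (here; there)
open import Data.Nat using (ℕ; zero; suc; _≤_; _<_; _+_; _⊓_; z≤n; s≤s; _≤?_)
open import Data.Nat.ListAction using (sum)
open import Data.Nat.Properties
  using ( ≤-trans; ≤-reflexive; <-≤-trans; ≤-<-trans; ≤-pred; ≰⇒>; <⇒≱; <-irrefl
        ; +-suc; +-monoʳ-≤; +-monoˡ-≤; m+n≤o⇒m≤o; m≤n⇒∃[o]m+o≡n; m⊓n≤m; m⊓n≤n; ⊓-glb )
open import Data.Product using (∃; ∃₂; _×_; _,_; proj₁; proj₂)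
open import Data.Sum as Sum using (_⊎_; inj₁; inj₂)
open import Data.Vec using ([]; _∷_; here; there; tabulate)
import Data.Vec.Functional as Vector
open import Data.Vec.Functional.Properties using (updateAt-updates; updateAt-minimal)
open import Data.Vec.Properties using ([]=⇒lookup; lookup⇒[]=; lookup∘tabulate)
open import Function.Base using (_∘_)
open import Function.Bundles using (_⇔_; mk⇔)
open import Function.Definitions using (Injective)
open import Relation.Binary.PropositionalEquality as ≡
  using (_≡_; _≢_; refl; trans; cong; cong₂; subst; subst₂)
open import Relation.Nullary using (¬_; yes; no; contradiction)
open import Relation.Nullary.Decidable using (⌊_⌋; _×-dec_; ¬?)

private
  variable
    n k : ℕ
    x y a b : Fin n
    p q S T : Subset n
    A : Adj n

-- Finite subsets

∣p∣≡∣p∩q∣+∣p─q∣ : ∀ (p q : Subset n) → ∣ p ∣ ≡ ∣ p ∩ q ∣ + ∣ p ─ q ∣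
∣p∣≡∣p∩q∣+∣p─q∣ []            []            = refl
∣p∣≡∣p∩q∣+∣p─q∣ (inside  ∷ p) (inside  ∷ q) = cong suc (∣p∣≡∣p∩q∣+∣p─q∣ p q)
∣p∣≡∣p∩q∣+∣p─q∣ (inside  ∷ p) (outside ∷ q) =
  trans (cong suc (∣p∣≡∣p∩q∣+∣p─q∣ p q)) (≡.sym (+-suc ∣ p ∩ q ∣ ∣ p ─ q ∣))
∣p∣≡∣p∩q∣+∣p─q∣ (outside ∷ p) (inside  ∷ q) = ∣p∣≡∣p∩q∣+∣p─q∣ p q
∣p∣≡∣p∩q∣+∣p─q∣ (outside ∷ p) (outside ∷ q) = ∣p∣≡∣p∩q∣+∣p─q∣ p q

∣p∪q∣≤∣p∣+∣q∣ : ∀ (p q : Subset n) → ∣ p ∪ q ∣ ≤ ∣ p ∣ + ∣ q ∣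
∣p∪q∣≤∣p∣+∣q∣ []            []            = z≤n
∣p∪q∣≤∣p∣+∣q∣ (inside  ∷ p) (s       ∷ q) =
  s≤s (≤-trans (∣p∪q∣≤∣p∣+∣q∣ p q) (+-monoʳ-≤ ∣ p ∣ (∣p∣≤∣x∷p∣ s q)))
∣p∪q∣≤∣p∣+∣q∣ (outside ∷ p) (inside  ∷ q) =
  ≤-trans (s≤s (∣p∪q∣≤∣p∣+∣q∣ p q)) (≤-reflexive (≡.sym (+-suc ∣ p ∣ ∣ q ∣)))
∣p∪q∣≤∣p∣+∣q∣ (outside ∷ p) (outside ∷ q) = ∣p∪q∣≤∣p∣+∣q∣ p q

x∈p─q⇒x∉q : ∀ {p q : Subset n} → x ∈ p ─ q → x ∉ q
x∈p─q⇒x∉q {p = _ ∷ _} {outside ∷ _} here       ()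
x∈p─q⇒x∉q {p = _ ∷ _} {_       ∷ _} (there x∈) (there x∈q) = x∈p─q⇒x∉q x∈ x∈q

x∈p∧y∉p⇒x≢y : x ∈ p → y ∉ p → x ≢ y
x∈p∧y∉p⇒x≢y x∈p y∉p refl = y∉p x∈p

∣q∣<∣p∣⇒∃[x∈p∖q] : ∣ q ∣ < ∣ p ∣ → ∃ λ x → x ∈ p × x ∉ q
∣q∣<∣p∣⇒∃[x∈p∖q] {q = q} {p = p} ∣q∣<∣p∣ with Fin.any? (λ x → x ∈? p ×-dec ¬? (x ∈? q))
... | yes witness = witness
... | no  ∄x      = contradiction (p⊆q⇒∣p∣≤∣q∣ p⊆q) (<⇒≱ ∣q∣<∣p∣)
  where
  p⊆q : p ⊆ q
  p⊆q {x} x∈p with x ∈? q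
  ... | yes x∈q = x∈q
  ... | no  x∉q = contradiction (x , x∈p , x∉q) ∄x

Subsingleton : Subset n → Set
Subsingleton p = ∀ {x y} → x ∈ p → y ∈ p → x ≡ y

Subsingleton⇒∣p∣≤1 : Subsingleton p → ∣ p ∣ ≤ 1
Subsingleton⇒∣p∣≤1 {n} {p} unique with nonempty? p
... | yes (x , x∈p) = ≤-trans (p⊆q⇒∣p∣≤∣q∣ p⊆⁅x⁆) (≤-reflexive (∣⁅x⁆∣≡1 x))
  where
  p⊆⁅x⁆ : p ⊆ ⁅ x ⁆
  p⊆⁅x⁆ y∈p = subst (_∈ ⁅ x ⁆) (unique x∈p y∈p) (x∈⁅x⁆ x)
... | no  ∄x = ≤-trans (≤-reflexive (trans (cong ∣_∣ (Empty-unique ∄x)) (∣⊥∣≡0 n))) z≤n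

avoiding-element : ∀ (S : Subset n) (F : Fin k → Subset n) →
                   (∀ j → Subsingleton (S ∩ F j)) → k < ∣ S ∣ → ∃ λ x → x ∈ S × ∀ j → x ∉ F j
avoiding-element {n} {zero} S F _ 0<∣S∣
  with ∣q∣<∣p∣⇒∃[x∈p∖q] {q = ⊥} (subst (_< ∣ S ∣) (≡.sym (∣⊥∣≡0 n)) 0<∣S∣)
... | x , x∈S , _ = x , x∈S , λ ()
avoiding-element {k = suc k} S F unique k<∣S∣
  with avoiding-element (S ─ F zero) (F ∘ suc) unique′ k<∣S─F₀∣
  where
  S─F₀∩F⊆S∩F : ∀ j → (S ─ F zero) ∩ F (suc j) ⊆ S ∩ F (suc j)
  S─F₀∩F⊆S∩F j x∈ with x∈p∩q⁻ (S ─ F zero) (F (suc j)) x∈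
  ... | x∈S─F₀ , x∈F = x∈p∩q⁺ (p─q⊆p S (F zero) x∈S─F₀ , x∈F)
  unique′ : ∀ j → Subsingleton ((S ─ F zero) ∩ F (suc j))
  unique′ j x∈ y∈ = unique (suc j) (S─F₀∩F⊆S∩F j x∈) (S─F₀∩F⊆S∩F j y∈)
  ∣S∣≤1+∣S─F₀∣ : ∣ S ∣ ≤ 1 + ∣ S ─ F zero ∣
  ∣S∣≤1+∣S─F₀∣ = ≤-trans (≤-reflexive (∣p∣≡∣p∩q∣+∣p─q∣ S (F zero)))
                         (+-monoˡ-≤ ∣ S ─ F zero ∣ (Subsingleton⇒∣p∣≤1 (unique zero)))
  k<∣S─F₀∣ : k < ∣ S ─ F zero ∣
  k<∣S─F₀∣ = ≤-pred (<-≤-trans k<∣S∣ ∣S∣≤1+∣S─F₀∣)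
... | x , x∈S─F₀ , x∉F = x , p─q⊆p S (F zero) x∈S─F₀ , λ where
  zero    → x∈p─q⇒x∉q x∈S─F₀
  (suc j) → x∉F j

pair : Fin n → Fin n → Subset n
pair x y = ⁅ x ⁆ ∪ ⁅ y ⁆

x∈pair : ∀ (x y : Fin n) → x ∈ pair x y
x∈pair x y = p⊆p∪q ⁅ y ⁆ (x∈⁅x⁆ x)

y∈pair : ∀ (x y : Fin n) → y ∈ pair x y
y∈pair x y = q⊆p∪q ⁅ x ⁆ ⁅ y ⁆ (x∈⁅x⁆ y)

∈pair⁻ : ∀ {z} (x y : Fin n) → z ∈ pair x y → z ≡ x ⊎ z ≡ y
∈pair⁻ x y z∈ with x∈p∪q⁻ ⁅ x ⁆ ⁅ y ⁆ z∈
... | inj₁ z∈⁅x⁆ = inj₁ (x∈⁅y⁆⇒x≡y x z∈⁅x⁆)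
... | inj₂ z∈⁅y⁆ = inj₂ (x∈⁅y⁆⇒x≡y y z∈⁅y⁆)

∣pair∣≤2 : ∀ (x y : Fin n) → ∣ pair x y ∣ ≤ 2
∣pair∣≤2 x y =
  ≤-trans (∣p∪q∣≤∣p∣+∣q∣ ⁅ x ⁆ ⁅ y ⁆) (≤-reflexive (cong₂ _+_ (∣⁅x⁆∣≡1 x) (∣⁅x⁆∣≡1 y)))

2≤∣p∣ : x ∈ p → y ∈ p → x ≢ y → 2 ≤ ∣ p ∣
2≤∣p∣ {x = x} {p = p} {y = y} x∈p y∈p x≢y =
  subst (_< ∣ p ∣) (∣⁅x⁆∣≡1 x) (p⊂q⇒∣p∣<∣q∣ (⁅x⁆⊆p , y , y∈p , y∉⁅x⁆))
  where
  ⁅x⁆⊆p : ⁅ x ⁆ ⊆ p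
  ⁅x⁆⊆p z∈⁅x⁆ = subst (_∈ p) (≡.sym (x∈⁅y⁆⇒x≡y x z∈⁅x⁆)) x∈p
  y∉⁅x⁆ : y ∉ ⁅ x ⁆
  y∉⁅x⁆ y∈⁅x⁆ = x≢y (≡.sym (x∈⁅y⁆⇒x≡y x y∈⁅x⁆))

2≤∣pair∣ : x ≢ y → 2 ≤ ∣ pair x y ∣
2≤∣pair∣ {x = x} {y = y} = 2≤∣p∣ (x∈pair x y) (y∈pair x y)

triple : Fin n → Fin n → Fin n → Subset n
triple x y z = pair x y ∪ ⁅ z ⁆

3≤∣triple∣ : ∀ {x y z : Fin n} → x ≢ y → z ≢ x → z ≢ y → 3 ≤ ∣ triple x y z ∣
3≤∣triple∣ {x = x} {y} {z} x≢y z≢x z≢y =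
  <-≤-trans (s≤s (2≤∣pair∣ x≢y)) (p⊂q⇒∣p∣<∣q∣ (p⊆p∪q ⁅ z ⁆ , z , z∈triple , z∉pair))
  where
  z∈triple : z ∈ triple x y z
  z∈triple = q⊆p∪q (pair x y) ⁅ z ⁆ (x∈⁅x⁆ z)
  z∉pair : z ∉ pair x y
  z∉pair z∈ with ∈pair⁻ x y z∈
  ... | inj₁ z≡x = z≢x z≡x
  ... | inj₂ z≡y = z≢y z≡y

enumerate : ∀ (S : Subset n) → Fin ∣ S ∣ → Fin n
enumerate (inside  ∷ S) zero    = zero
enumerate (inside  ∷ S) (suc i) = suc (enumerate S i)
enumerate (outside ∷ S) i       = suc (enumerate S i)

enumerate-∈ : ∀ (S : Subset n) i → enumerate S i ∈ S
enumerate-∈ (inside  ∷ S) zero    = here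
enumerate-∈ (inside  ∷ S) (suc i) = there (enumerate-∈ S i)
enumerate-∈ (outside ∷ S) i       = there (enumerate-∈ S i)

enumerate-injective : ∀ (S : Subset n) → Injective _≡_ _≡_ (enumerate S)
enumerate-injective (inside  ∷ S) {zero}  {zero}  _  = refl
enumerate-injective (inside  ∷ S) {suc i} {suc j} eq =
  cong suc (enumerate-injective S (Fin.suc-injective eq))
enumerate-injective (outside ∷ S)                 eq = enumerate-injective S (Fin.suc-injective eq)

enumerate-surjective : ∀ (S : Subset n) → x ∈ S → ∃ λ i → enumerate S i ≡ x
enumerate-surjective (inside  ∷ S) here        = zero , refl
enumerate-surjective (inside  ∷ S) (there x∈S) with enumerate-surjective S x∈S
... | i , eq = suc i , cong suc eq
enumerate-surjective (outside ∷ S) (there x∈S) with enumerate-surjective S x∈S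
... | i , eq = i , cong suc eq

-- Neighbourhoods and degrees

neighbourhood : Adj n → Fin n → Subset n
neighbourhood A v = tabulate (A v)

∈-neighbourhood⁻ : ∀ (A : Adj n) {v} → x ∈ neighbourhood A v → A v x ≡ true
∈-neighbourhood⁻ {x = x} A {v} x∈ = trans (≡.sym (lookup∘tabulate (A v) x)) ([]=⇒lookup x∈)

∈-neighbourhood⁺ : ∀ (A : Adj n) {v} → A v x ≡ true → x ∈ neighbourhood A v
∈-neighbourhood⁺ {x = x} A {v} Avx = lookup⇒[]= x _ (trans (lookup∘tabulate (A v) x) Avx)

degree≡∣neighbourhood∣ : ∀ (A : Adj n) v → degree A v ≡ ∣ neighbourhood A v ∣
degree≡∣neighbourhood∣ {n} A v =
  trans (cong sum (map-tabulate (λ u → u) indicator)) (sum-indicator≡∣tabulate∣ (A v))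
  where
  indicator : Fin n → ℕ
  indicator u = if A v u then 1 else 0
  sum-indicator≡∣tabulate∣ : ∀ {k} (f : Fin k → Bool) →
                             sum (List.tabulate (λ u → if f u then 1 else 0)) ≡ ∣ tabulate f ∣
  sum-indicator≡∣tabulate∣ {zero}  f = refl
  sum-indicator≡∣tabulate∣ {suc k} f with f zero | sum-indicator≡∣tabulate∣ (f ∘ suc)
  ... | true  | eq = cong suc eq
  ... | false | eq = eq

foldr-⊓≤ : ∀ b {xs : List ℕ} {x} → x List.∈ xs → foldr _⊓_ b xs ≤ x
foldr-⊓≤ b {x List.∷ xs} (here refl) = m⊓n≤m x _
foldr-⊓≤ b {x List.∷ xs} (there x∈)  = ≤-trans (m⊓n≤n x _) (foldr-⊓≤ b x∈)

≤-foldr-⊓ : ∀ {b m} (xs : List ℕ) → m ≤ b → (∀ {x} → x List.∈ xs → m ≤ x) → m ≤ foldr _⊓_ b xs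
≤-foldr-⊓ List.[]       m≤b _    = m≤b
≤-foldr-⊓ (x List.∷ xs) m≤b m≤xs = ⊓-glb (m≤xs (here refl)) (≤-foldr-⊓ xs m≤b (m≤xs ∘ there))

minDegree≤degree : ∀ (A : Adj (suc n)) v → minDegree A ≤ degree A v
minDegree≤degree A v = foldr-⊓≤ (degree A zero) (∈-map⁺ (degree A) (∈-allFin v))

≤minDegree : ∀ (A : Adj (suc n)) {m} → (∀ v → m ≤ degree A v) → m ≤ minDegree A
≤minDegree {n} A {m} m≤deg = ≤-foldr-⊓ (map (degree A) (allFin (suc n))) (m≤deg zero) m≤degrees
  where
  m≤degrees : ∀ {d} → d List.∈ map (degree A) (allFin (suc n)) → m ≤ d
  m≤degrees d∈ with ∈-map⁻ (degree A) d∈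
  ... | v , _ , refl = m≤deg v

-- Complements and edge deletion

compl≡true⁻ : ∀ (A : Adj n) → compl A x y ≡ true → x ≢ y × A x y ≡ false
compl≡true⁻ {x = x} {y = y} A eq with x ≟ y | A x y
... | yes _   | _     = contradiction eq λ ()
... | no  x≢y | false = x≢y , refl
... | no  _   | true  = contradiction eq λ ()

compl≡true⁺ : ∀ (A : Adj n) → x ≢ y → A x y ≡ false → compl A x y ≡ true
compl≡true⁺ {x = x} {y = y} A x≢y Axy≡false with x ≟ y
... | yes x≡y = contradiction x≡y x≢y
... | no  _   = cong not Axy≡false

compl≡false⁻ : ∀ (A : Adj n) → x ≢ y → compl A x y ≡ false → A x y ≡ true
compl≡false⁻ {x = x} {y = y} A x≢y eq with x ≟ y | A x y
... | yes x≡y | _     = contradiction x≡y x≢y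
... | no  _   | true  = refl
... | no  _   | false = contradiction eq λ ()

adj≡true⇒compl≡false : ∀ (A : Adj n) → A x y ≡ true → compl A x y ≡ false
adj≡true⇒compl≡false {x = x} {y = y} A Axy≡true with x ≟ y
... | yes _ = refl
... | no  _ = cong not Axy≡true

compl-irrefl : ∀ (A : Adj n) v → compl A v v ≡ false
compl-irrefl A v with v ≟ v
... | yes _   = refl
... | no  v≢v = contradiction refl v≢v

independent⇒compl≡true : Independent A S → x ∈ S → y ∈ S → x ≢ y → compl A x y ≡ true
independent⇒compl≡true {A = A} indS x∈S y∈S x≢y = compl≡true⁺ A x≢y (indS _ _ x∈S y∈S)

deleteEdge-false : ∀ (A : Adj n) a b → A x y ≡ false → deleteEdge A a b x y ≡ false
deleteEdge-false {x = x} {y = y} A a b Axy≡false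
  with (⌊ x ≟ a ⌋ ∧ ⌊ y ≟ b ⌋) ∨ (⌊ x ≟ b ⌋ ∧ ⌊ y ≟ a ⌋)
... | true  = refl
... | false = Axy≡false

deleteEdge-removes : ∀ (A : Adj n) a b → deleteEdge A a b a b ≡ false
deleteEdge-removes A a b with a ≟ a | b ≟ b
... | yes _   | yes _   = refl
... | no  a≢a | _       = contradiction refl a≢a
... | yes _   | no  b≢b = contradiction refl b≢b

≢⇒⌊≟⌋∧⌊≟⌋≡false : ∀ (x a y b : Fin n) → x ≢ a ⊎ y ≢ b → ⌊ x ≟ a ⌋ ∧ ⌊ y ≟ b ⌋ ≡ false
≢⇒⌊≟⌋∧⌊≟⌋≡false x a y b (inj₁ x≢a) with x ≟ a
... | yes x≡a = contradiction x≡a x≢a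
... | no  _   = refl
≢⇒⌊≟⌋∧⌊≟⌋≡false x a y b (inj₂ y≢b) with y ≟ b
... | yes y≡b = contradiction y≡b y≢b
... | no  _   = ∧-zeroʳ ⌊ x ≟ a ⌋

deleteEdge-elsewhere : ∀ (A : Adj n) a b → x ≢ a ⊎ y ≢ b → x ≢ b ⊎ y ≢ a →
                       deleteEdge A a b x y ≡ A x y
deleteEdge-elsewhere {x = x} {y = y} A a b ≢ab ≢ba
  rewrite ≢⇒⌊≟⌋∧⌊≟⌋≡false x a y b ≢ab | ≢⇒⌊≟⌋∧⌊≟⌋≡false x b y a ≢ba = refl

removeEdge : Graph n → Fin n → Fin n → Graph n
removeEdge G a b = record
  { adj    = deleteEdge (adj G) a b
  ; sym    = λ u v → cong₂ (λ c w → if c then false else w) (endpoints-sym u v) (Graph.sym G u v)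
  ; irrefl = λ v → deleteEdge-false (adj G) a b (irrefl G v)
  }
  where
  endpoints-sym : ∀ u v → (⌊ u ≟ a ⌋ ∧ ⌊ v ≟ b ⌋) ∨ (⌊ u ≟ b ⌋ ∧ ⌊ v ≟ a ⌋)
                        ≡ (⌊ v ≟ a ⌋ ∧ ⌊ u ≟ b ⌋) ∨ (⌊ v ≟ b ⌋ ∧ ⌊ u ≟ a ⌋)
  endpoints-sym u v = trans (∨-comm (⌊ u ≟ a ⌋ ∧ ⌊ v ≟ b ⌋) _)
                            (cong₂ _∨_ (∧-comm ⌊ u ≟ b ⌋ _) (∧-comm ⌊ u ≟ a ⌋ _))

independent-deleteEdge⁻ : Independent (deleteEdge A a b) S → a ∉ S ⊎ b ∉ S → Independent A S
independent-deleteEdge⁻ {A = A} {a = a} {b = b} indS a∉S⊎b∉S u v u∈S v∈S =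
  trans (≡.sym (deleteEdge-elsewhere A a b ≢ab ≢ba)) (indS u v u∈S v∈S)
  where
  ≢ab : u ≢ a ⊎ v ≢ b
  ≢ab = Sum.map (x∈p∧y∉p⇒x≢y u∈S) (x∈p∧y∉p⇒x≢y v∈S) a∉S⊎b∉S
  ≢ba : u ≢ b ⊎ v ≢ a
  ≢ba = Sum.map (x∈p∧y∉p⇒x≢y u∈S) (x∈p∧y∉p⇒x≢y v∈S) (Sum.swap a∉S⊎b∉S)

-- Independent sets and the classes W_p

Disjoint-sym : Disjoint S T → Disjoint T S
Disjoint-sym disjoint x x∈T x∈S = disjoint x x∈S x∈T

maximum-⊆ : MaximumIndependent A S → S ⊆ T → Independent A T → MaximumIndependent A T
maximum-⊆ (_ , maxS) S⊆T indT = indT , λ R indR → ≤-trans (maxS R indR) (p⊆q⇒∣p∣≤∣q∣ S⊆T)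

Packing : Adj n → (Fin k → Subset n) → Set
Packing A Bs = (∀ i → Independent A (Bs i)) × (∀ i j → i ≢ j → Disjoint (Bs i) (Bs j))

replace-in-packing : ∀ {Bs : Fin k → Subset n} {i} → Packing A Bs → Independent A T →
                     (∀ j → i ≢ j → Disjoint T (Bs j)) → Bs i ⊆ T →
                     ∃ λ Bs′ → Packing A Bs′ × (∀ j → Bs j ⊆ Bs′ j) × Bs′ i ≡ T
replace-in-packing {A = A} {T = T} {Bs = Bs} {i} (indBs , disBs) indT disT Bsi⊆T =
  Bs′ , (ind′ , dis′) , Bs⊆Bs′ , Bs′-at
  where
  Bs′ : Fin _ → Subset _
  Bs′ = Vector.updateAt Bs i (λ _ → T)
  Bs′-at : Bs′ i ≡ T
  Bs′-at = updateAt-updates i Bs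
  Bs′-elsewhere : ∀ {j} → j ≢ i → Bs′ j ≡ Bs j
  Bs′-elsewhere {j} j≢i = updateAt-minimal j i Bs j≢i
  ind′ : ∀ j → Independent A (Bs′ j)
  ind′ j with j ≟ i
  ... | yes refl = subst (Independent A) (≡.sym Bs′-at) indT
  ... | no  j≢i  = subst (Independent A) (≡.sym (Bs′-elsewhere j≢i)) (indBs j)
  dis′ : ∀ j l → j ≢ l → Disjoint (Bs′ j) (Bs′ l)
  dis′ j l j≢l with j ≟ i | l ≟ i
  ... | yes refl | yes refl = contradiction refl j≢l
  ... | yes refl | no  l≢i  =
    subst₂ Disjoint (≡.sym Bs′-at) (≡.sym (Bs′-elsewhere l≢i)) (disT l (l≢i ∘ ≡.sym))
  ... | no  j≢i  | yes refl =
    subst₂ Disjoint (≡.sym (Bs′-elsewhere j≢i)) (≡.sym Bs′-at) (Disjoint-sym (disT j (j≢i ∘ ≡.sym)))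
  ... | no  j≢i  | no  l≢i  =
    subst₂ Disjoint (≡.sym (Bs′-elsewhere j≢i)) (≡.sym (Bs′-elsewhere l≢i)) (disBs j l j≢l)
  Bs⊆Bs′ : ∀ j → Bs j ⊆ Bs′ j
  Bs⊆Bs′ j with j ≟ i
  ... | yes refl = subst (Bs i ⊆_) (≡.sym Bs′-at) Bsi⊆T
  ... | no  j≢i  = subst (Bs j ⊆_) (≡.sym (Bs′-elsewhere j≢i)) (λ x∈ → x∈)

module _ (G : Graph n) where

  adj≡true⇒≢ : adj G x y ≡ true → x ≢ y
  adj≡true⇒≢ {x = x} Axy≡true refl = contradiction (trans (≡.sym Axy≡true) (irrefl G x)) λ ()

  independent-⁅⁆ : ∀ x → Independent (adj G) ⁅ x ⁆
  independent-⁅⁆ x u v u∈ v∈ rewrite x∈⁅y⁆⇒x≡y x u∈ | x∈⁅y⁆⇒x≡y x v∈ = irrefl G x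

  independent-∪ : Independent (adj G) S → Independent (adj G) T →
                  (∀ {x y} → x ∈ S → y ∈ T → adj G x y ≡ false) → Independent (adj G) (S ∪ T)
  independent-∪ {S = S} {T} indS indT cross u v u∈ v∈ with x∈p∪q⁻ S T u∈ | x∈p∪q⁻ S T v∈
  ... | inj₁ u∈S | inj₁ v∈S = indS u v u∈S v∈S
  ... | inj₂ u∈T | inj₂ v∈T = indT u v u∈T v∈T
  ... | inj₁ u∈S | inj₂ v∈T = cross u∈S v∈T
  ... | inj₂ u∈T | inj₁ v∈S = trans (Graph.sym G u v) (cross v∈S u∈T)

  independent-pair : adj G x y ≡ false → Independent (adj G) (pair x y)
  independent-pair {x = x} {y} Axy≡false = independent-∪ (independent-⁅⁆ x) (independent-⁅⁆ y) cross
    where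
    cross : ∀ {u v} → u ∈ ⁅ x ⁆ → v ∈ ⁅ y ⁆ → adj G u v ≡ false
    cross u∈ v∈ rewrite x∈⁅y⁆⇒x≡y x u∈ | x∈⁅y⁆⇒x≡y y v∈ = Axy≡false

  independent-triple : ∀ {x y z} → adj G x y ≡ false → adj G x z ≡ false → adj G y z ≡ false →
                       Independent (adj G) (triple x y z)
  independent-triple {x = x} {y} {z} Axy≡false Axz≡false Ayz≡false =
    independent-∪ (independent-pair Axy≡false) (independent-⁅⁆ z) cross
    where
    cross : ∀ {u v} → u ∈ pair x y → v ∈ ⁅ z ⁆ → adj G u v ≡ false
    cross u∈ v∈ rewrite x∈⁅y⁆⇒x≡y z v∈ with ∈pair⁻ x y u∈
    ... | inj₁ refl = Axz≡false
    ... | inj₂ refl = Ayz≡false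

  singletons-packing : ∀ {f : Fin k → Fin n} → Injective _≡_ _≡_ f → Packing (adj G) (λ i → ⁅ f i ⁆)
  singletons-packing {f = f} f-injective = (λ i → independent-⁅⁆ (f i)) , disjoint
    where
    disjoint : ∀ i j → i ≢ j → Disjoint ⁅ f i ⁆ ⁅ f j ⁆
    disjoint i j i≢j z z∈fi z∈fj =
      i≢j (f-injective (trans (≡.sym (x∈⁅y⁆⇒x≡y (f i) z∈fi)) (x∈⁅y⁆⇒x≡y (f j) z∈fj)))

W-restrict : ∀ {A : Adj n} k r → W A (k + r) → W A k
W-restrict {n} {A} k r (k+r≤n , extend) = m+n≤o⇒m≤o k k+r≤n , λ As indAs disAs →
  let (Ms , maxMs , disMs , pad⊆Ms) = extend (pad As) (independent-pad indAs) (disjoint-pad disAs)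
  in  (λ i → Ms (i ↑ˡ r)) , (λ i → maxMs (i ↑ˡ r)) ,
      (λ i j i≢j → disMs _ _ (i≢j ∘ Fin.↑ˡ-injective r i j)) ,
      (λ i → subst (_⊆ Ms (i ↑ˡ r)) (pad-↑ˡ As i) (pad⊆Ms (i ↑ˡ r)))
  where
  pad : (Fin k → Subset n) → Fin (k + r) → Subset n
  pad As i = Sum.[ As , (λ _ → ⊥) ]′ (splitAt k i)

  pad-↑ˡ : ∀ As i → pad As (i ↑ˡ r) ≡ As i
  pad-↑ˡ As i rewrite Fin.splitAt-↑ˡ k i r = refl

  splitAt-injective : ∀ {i j} → splitAt k i ≡ splitAt k j → i ≡ j
  splitAt-injective {i} {j} eq = begin
    i                      ≡⟨ Fin.join-splitAt k r i ⟨
    join k r (splitAt k i) ≡⟨ cong (join k r) eq ⟩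
    join k r (splitAt k j) ≡⟨ Fin.join-splitAt k r j ⟩
    j                      ∎
    where open ≡.≡-Reasoning

  independent-pad : ∀ {As} → (∀ i → Independent A (As i)) → ∀ i → Independent A (pad As i)
  independent-pad indAs i with splitAt k i
  ... | inj₁ i′ = indAs i′
  ... | inj₂ _  = λ _ _ u∈⊥ → contradiction u∈⊥ ∉⊥

  disjoint-pad : ∀ {As} → (∀ i j → i ≢ j → Disjoint (As i) (As j)) →
                 ∀ i j → i ≢ j → Disjoint (pad As i) (pad As j)
  disjoint-pad disAs i j i≢j with splitAt k i in eqi | splitAt k j in eqj
  ... | inj₁ i′ | inj₁ j′ = disAs i′ j′ λ { refl → i≢j (splitAt-injective (trans eqi (≡.sym eqj))) }
  ... | inj₁ _  | inj₂ _  = λ _ _ u∈⊥ → contradiction u∈⊥ ∉⊥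
  ... | inj₂ _  | _       = λ _ u∈⊥ _ → contradiction u∈⊥ ∉⊥

W-mono : ∀ {A : Adj n} {k m} → k ≤ m → W A m → W A k
W-mono {k = k} k≤m Wm with m≤n⇒∃[o]m+o≡n k≤m
... | r , refl = W-restrict k r Wm

-- Graphs with independence number at most two

module IndependenceAtMostTwo (G : Graph n) (α≤2 : ∀ S → Independent (adj G) S → ∣ S ∣ ≤ 2) where

  private
    H : Adj n
    H = compl (adj G)

  compl-triangleFree : TriangleFree H
  compl-triangleFree x y z Hxy Hyz Hxz
    with compl≡true⁻ (adj G) Hxy | compl≡true⁻ (adj G) Hyz | compl≡true⁻ (adj G) Hxz
  ... | x≢y , Axy≡false | y≢z , Ayz≡false | x≢z , Axz≡false =
    <⇒≱ (3≤∣triple∣ x≢y (x≢z ∘ ≡.sym) (y≢z ∘ ≡.sym))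
        (α≤2 _ (independent-triple G Axy≡false Axz≡false Ayz≡false))

  2≤∣S∣⇒maximum : Independent (adj G) S → 2 ≤ ∣ S ∣ → MaximumIndependent (adj G) S
  2≤∣S∣⇒maximum indS 2≤∣S∣ = indS , λ R indR → ≤-trans (α≤2 R indR) 2≤∣S∣

  pair-maximum : H x y ≡ true → MaximumIndependent (adj G) (pair x y)
  pair-maximum Hxy with compl≡true⁻ (adj G) Hxy
  ... | x≢y , Axy≡false = 2≤∣S∣⇒maximum (independent-pair G Axy≡false) (2≤∣pair∣ x≢y)

  neighbourhood∩independent-subsingleton : ∀ {v} → Independent (adj G) S →
                                           Subsingleton (neighbourhood H v ∩ S)
  neighbourhood∩independent-subsingleton {S = S} {v} indS {x} {y} x∈ y∈
    with x∈p∩q⁻ (neighbourhood H v) S x∈ | x∈p∩q⁻ (neighbourhood H v) S y∈ | x ≟ y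
  ... | _ , _ | _ , _ | yes x≡y = x≡y
  ... | x∈N , x∈S | y∈N , y∈S | no x≢y = ⊥-elim (compl-triangleFree v x y
    (∈-neighbourhood⁻ H x∈N) (independent⇒compl≡true indS x∈S y∈S x≢y) (∈-neighbourhood⁻ H y∈N))

  free-neighbour : (F : Fin k → Subset n) → (∀ j → Independent (adj G) (F j)) →
                   ∀ v → k < degree H v → ∃ λ w → H v w ≡ true × ∀ j → w ∉ F j
  free-neighbour F indF v k<deg
    with avoiding-element (neighbourhood H v) F (neighbourhood∩independent-subsingleton ∘ indF)
                          (subst (_ <_) (degree≡∣neighbourhood∣ H v) k<deg)
  ... | w , w∈N , w∉F = w , ∈-neighbourhood⁻ H w∈N , w∉F

  -- The vertex v₀ is needed only to start from when S is empty.
  extend-to-edge : (F : Fin k → Subset n) → (∀ j → Independent (adj G) (F j)) →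
                   (∀ v → k < degree H v) → (v₀ : Fin n) → ∣ S ∣ < 2 → (∀ j → Disjoint S (F j)) →
                   ∃₂ λ x y → H x y ≡ true × S ⊆ pair x y × (∀ j → x ∉ F j) × (∀ j → y ∉ F j)
  extend-to-edge {S = S} F indF deg v₀ ∣S∣<2 disjoint with nonempty? S
  ... | yes (v , v∈S) with free-neighbour F indF v (deg v)
  ...   | w , Hvw , w∉F = v , w , Hvw , S⊆vw , (λ j v∈F → disjoint j v v∈S v∈F) , w∉F
    where
    S⊆vw : S ⊆ pair v w
    S⊆vw {u} u∈S with u ≟ v
    ... | yes refl = x∈pair u w
    ... | no  u≢v  = contradiction (2≤∣p∣ u∈S v∈S u≢v) (<⇒≱ ∣S∣<2)
  extend-to-edge {S = S} F indF deg v₀ ∣S∣<2 disjoint | no ∄v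
    with free-neighbour F indF v₀ (deg v₀)
  ... | x , _ , x∉F with free-neighbour F indF x (deg x)
  ...   | y , Hxy , y∉F = x , y , Hxy , (λ u∈S → contradiction (_ , u∈S) ∄v) , x∉F , y∉F

  extend-at : (∀ v → k < degree H v) → Fin n →
              ∀ {Bs : Fin (suc k) → Subset n} → Packing (adj G) Bs → ∀ i →
              ∃ λ Bs′ → Packing (adj G) Bs′ × (∀ j → Bs j ⊆ Bs′ j) ×
                        MaximumIndependent (adj G) (Bs′ i)
  extend-at deg v₀ {Bs} packing@(indBs , disBs) i with 2 ≤? ∣ Bs i ∣
  ... | yes 2≤∣Bsi∣ = Bs , packing , (λ _ x∈ → x∈) , 2≤∣S∣⇒maximum (indBs i) 2≤∣Bsi∣
  ... | no  2≰∣Bsi∣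
    with extend-to-edge (Bs ∘ punchIn i) (indBs ∘ punchIn i) deg v₀ (≰⇒> 2≰∣Bsi∣)
                        (λ j → disBs i (punchIn i j) (Fin.punchInᵢ≢i i j ∘ ≡.sym))
  ...   | x , y , Hxy , Bsi⊆xy , x∉others , y∉others
    with replace-in-packing packing (proj₁ (pair-maximum Hxy)) disjoint Bsi⊆xy
    where
    outside-others : ∀ {z} → (∀ j → z ∉ Bs (punchIn i j)) → ∀ j → i ≢ j → z ∉ Bs j
    outside-others z∉ j i≢j z∈Bsj =
      z∉ (punchOut i≢j) (subst (λ l → _ ∈ Bs l) (≡.sym (Fin.punchIn-punchOut i≢j)) z∈Bsj)
    disjoint : ∀ j → i ≢ j → Disjoint (pair x y) (Bs j)
    disjoint j i≢j z z∈xy with ∈pair⁻ x y z∈xy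
    ... | inj₁ refl = outside-others x∉others j i≢j
    ... | inj₂ refl = outside-others y∉others j i≢j
  ...     | Bs′ , packing′ , Bs⊆Bs′ , Bs′i≡xy =
    Bs′ , packing′ , Bs⊆Bs′ , subst (MaximumIndependent (adj G)) (≡.sym Bs′i≡xy) (pair-maximum Hxy)

  extend-all : (∀ v → k < degree H v) → Fin n →
               ∀ {Bs : Fin (suc k) → Subset n} → Packing (adj G) Bs → (is : List (Fin (suc k))) →
               ∃ λ Bs′ → Packing (adj G) Bs′ × (∀ j → Bs j ⊆ Bs′ j) ×
                         All (λ i → MaximumIndependent (adj G) (Bs′ i)) is
  extend-all deg v₀ packing List.[]          = _ , packing , (λ _ x∈ → x∈) , []
  extend-all deg v₀ packing (i List.∷ is) with extend-all deg v₀ packing is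
  ... | Bs₁ , packing₁ , Bs⊆Bs₁ , maximum₁ with extend-at deg v₀ packing₁ i
  ...   | Bs₂ , packing₂ , Bs₁⊆Bs₂ , maximumᵢ =
    Bs₂ , packing₂ , (λ j x∈ → Bs₁⊆Bs₂ j (Bs⊆Bs₁ j x∈)) ,
    maximumᵢ ∷ All.map (λ {j} maximumⱼ → maximum-⊆ maximumⱼ (Bs₁⊆Bs₂ j) (proj₁ packing₂ j)) maximum₁

  degree≥⇒W : ∀ {p} → 1 ≤ p → (∀ v → p ≤ degree H v) → Fin n → W (adj G) p
  degree≥⇒W {suc k} _ deg v₀ = ≤-trans (deg v₀) degree≤n , λ As indAs disAs →
    let (Ms , (_ , disMs) , As⊆Ms , maximum) = extend-all deg v₀ (indAs , disAs) (allFin (suc k))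
    in  Ms , (λ i → All.lookup maximum (∈-allFin i)) , disMs , As⊆Ms
    where
    degree≤n : degree H v₀ ≤ n
    degree≤n = subst (_≤ n) (≡.sym (degree≡∣neighbourhood∣ H v₀)) (∣p∣≤n (neighbourhood H v₀))

  wellCovered : (∀ v → 0 < degree H v) → Fin n → WellCovered (adj G)
  wellCovered deg v₀ M (indM , maximal) = 2≤∣S∣⇒maximum indM 2≤∣M∣
    where
    2≤∣M∣ : 2 ≤ ∣ M ∣
    2≤∣M∣ with 2 ≤? ∣ M ∣
    ... | yes 2≤∣M∣ = 2≤∣M∣
    ... | no  2≰∣M∣ with extend-to-edge (λ ()) (λ ()) deg v₀ (≰⇒> 2≰∣M∣) (λ ())
    ...   | x , y , Hxy , M⊆xy , _ =
      ≤-trans (2≤∣pair∣ (proj₁ (compl≡true⁻ (adj G) Hxy)))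
              (p⊆q⇒∣p∣≤∣q∣ (maximal (pair x y) (proj₁ (pair-maximum Hxy)) M⊆xy))

  maximalTriangleFree⇒αCritical : MaximalTriangleFree H → AlphaCritical (adj G)
  maximalTriangleFree⇒αCritical (_ , common) a b Aab k l αk αl
    with common a b (adj≡true⇒≢ G Aab) (adj≡true⇒compl≡false (adj G) Aab)
  ... | w , Haw , Hwb with compl≡true⁻ (adj G) Haw | compl≡true⁻ (adj G) Hwb
  ...   | a≢w , Aaw≡false | w≢b , Awb≡false =
    ≤-trans (s≤s k≤2) (≤-trans 3≤∣abw∣ (proj₂ αl (triple a b w) independent-abw))
    where
    k≤2 : k ≤ 2
    k≤2 with proj₁ αk
    ... | S , indS , refl = α≤2 S indS
    3≤∣abw∣ : 3 ≤ ∣ triple a b w ∣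
    3≤∣abw∣ = 3≤∣triple∣ (adj≡true⇒≢ G Aab) (a≢w ∘ ≡.sym) w≢b
    independent-abw : Independent (deleteEdge (adj G) a b) (triple a b w)
    independent-abw = independent-triple (removeEdge G a b)
      (deleteEdge-removes (adj G) a b)
      (deleteEdge-false (adj G) a b Aaw≡false)
      (deleteEdge-false (adj G) a b (trans (Graph.sym G b w) Awb≡false))

  no-common-neighbour⇒α[G-uv]≤2 : ∀ {u v} → u ≢ v → ¬ (∃ λ w → H u w ≡ true × H w v ≡ true) →
                                   ∀ S → Independent (deleteEdge (adj G) u v) S → ∣ S ∣ ≤ 2
  no-common-neighbour⇒α[G-uv]≤2 {u} {v} u≢v ∄w S indS with u ∈? S | v ∈? S
  ... | no  u∉S | _       = α≤2 S (independent-deleteEdge⁻ indS (inj₁ u∉S))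
  ... | yes _   | no  v∉S = α≤2 S (independent-deleteEdge⁻ indS (inj₂ v∉S))
  ... | yes u∈S | yes v∈S with ∣ S ∣ ≤? 2
  ...   | yes ∣S∣≤2 = ∣S∣≤2
  ...   | no  ∣S∣≰2 with ∣q∣<∣p∣⇒∃[x∈p∖q] (≤-<-trans (∣pair∣≤2 u v) (≰⇒> ∣S∣≰2))
  ...     | w , w∈S , w∉uv = contradiction (w , Huw , Hwv) ∄w
    where
    w≢u : w ≢ u
    w≢u refl = w∉uv (x∈pair u v)
    w≢v : w ≢ v
    w≢v refl = w∉uv (y∈pair u v)
    Huw : H u w ≡ true
    Huw = compl≡true⁺ (adj G) (w≢u ∘ ≡.sym)
      (trans (≡.sym (deleteEdge-elsewhere (adj G) u v (inj₂ w≢v) (inj₁ u≢v))) (indS u w u∈S w∈S))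
    Hwv : H w v ≡ true
    Hwv = compl≡true⁺ (adj G) w≢v
      (trans (≡.sym (deleteEdge-elsewhere (adj G) u v (inj₁ w≢u) (inj₁ w≢v))) (indS w v w∈S v∈S))

  v∉neighbourhood : ∀ v → v ∉ neighbourhood H v
  v∉neighbourhood v v∈ =
    contradiction (trans (≡.sym (∈-neighbourhood⁻ H v∈)) (compl-irrefl (adj G) v)) λ ()

  closedNeighbours : ∀ v → Fin (suc ∣ neighbourhood H v ∣) → Fin n
  closedNeighbours v = v Vector.∷ enumerate (neighbourhood H v)

  closedNeighbours-injective : ∀ v → Injective _≡_ _≡_ (closedNeighbours v)
  closedNeighbours-injective v {zero}  {zero}  _  = refl
  closedNeighbours-injective v {zero}  {suc j} eq =
    contradiction (subst (_∈ neighbourhood H v) (≡.sym eq) (enumerate-∈ _ j)) (v∉neighbourhood v)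
  closedNeighbours-injective v {suc i} {zero}  eq =
    contradiction (subst (_∈ neighbourhood H v) eq (enumerate-∈ _ i)) (v∉neighbourhood v)
  closedNeighbours-injective v {suc i} {suc j} eq = cong suc (enumerate-injective _ eq)

  module IndependentPair (S₀ : Subset n) (indS₀ : Independent (adj G) S₀) (∣S₀∣≡2 : ∣ S₀ ∣ ≡ 2)
    where

    ¬W[1+degree] : ∀ v → ¬ W (adj G) (suc (degree H v))
    ¬W[1+degree] v W[1+d] with subst (λ d → W (adj G) (suc d)) (degree≡∣neighbourhood∣ H v) W[1+d]
    ... | _ , extend with extend (λ i → ⁅ closedNeighbours v i ⁆)
                                (proj₁ (singletons-packing G (closedNeighbours-injective v)))
                                (proj₂ (singletons-packing G (closedNeighbours-injective v)))
    ...   | Ms , maximum , disjoint , ⊆Ms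
      with ∣q∣<∣p∣⇒∃[x∈p∖q] (subst (_< ∣ Ms zero ∣) (≡.sym (∣⁅x⁆∣≡1 v)) 2≤∣M₀∣)
      where
      2≤∣M₀∣ : 2 ≤ ∣ Ms zero ∣
      2≤∣M₀∣ = subst (_≤ ∣ Ms zero ∣) ∣S₀∣≡2 (proj₂ (maximum zero) S₀ indS₀)
    ...     | w , w∈M₀ , w∉⁅v⁆
      with enumerate-surjective (neighbourhood H v) (∈-neighbourhood⁺ H
             (independent⇒compl≡true (proj₁ (maximum zero)) (⊆Ms zero (x∈⁅x⁆ v)) w∈M₀
                                     (x∉⁅y⁆⇒x≢y w∉⁅v⁆ ∘ ≡.sym)))
    ...       | a , refl = disjoint zero (suc a) (λ ()) _ w∈M₀ (⊆Ms (suc a) (x∈⁅x⁆ _))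

    W⇒≤degree : ∀ {q} → W (adj G) q → ∀ v → q ≤ degree H v
    W⇒≤degree {q} Wq v with q ≤? degree H v
    ... | yes q≤deg = q≤deg
    ... | no  q≰deg = contradiction (W-mono (≰⇒> q≰deg) Wq) (¬W[1+degree] v)

    αCritical⇒maximalTriangleFree : AlphaCritical (adj G) → MaximalTriangleFree H
    αCritical⇒maximalTriangleFree critical = compl-triangleFree , common-neighbour
      where
      common-neighbour : ∀ u v → u ≢ v → H u v ≡ false → ∃ λ w → H u w ≡ true × H w v ≡ true
      common-neighbour u v u≢v Huv≡false
        with Fin.any? (λ w → (H u w Bool.≟ true) ×-dec (H w v Bool.≟ true))
      ... | yes found = found
      ... | no  ∄w    =
        ⊥-elim (<-irrefl refl (critical u v (compl≡false⁻ (adj G) u≢v Huv≡false) 2 2 α[G] α[G-uv]))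
        where
        α[G] : IsAlpha (adj G) 2
        α[G] = (S₀ , indS₀ , ∣S₀∣≡2) , α≤2
        α[G-uv] : IsAlpha (deleteEdge (adj G) u v) 2
        α[G-uv] = (S₀ , (λ x y x∈ y∈ → deleteEdge-false (adj G) u v (indS₀ x y x∈ y∈)) , ∣S₀∣≡2)
                , no-common-neighbour⇒α[G-uv]≤2 u≢v ∄w

corollary6p1 : ∀ {m} (G : Graph (suc m)) → IsAlpha (adj G) 2 →
    (p : ℕ) → 1 ≤ p →
    ((AlphaCritical (adj G) × W (adj G) p) ⇔
       (MaximalTriangleFree (compl (adj G)) × p ≤ minDegree (compl (adj G))))
    × ((AlphaCritical (adj G) × W (adj G) p) →
       WellCovered (adj G) × IsW (adj G) (minDegree (compl (adj G))))
corollary6p1 {m} G ((S₀ , indS₀ , ∣S₀∣≡2) , α≤2) p 1≤p = mk⇔ forward backward , consequences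
  where
  open IndependenceAtMostTwo G α≤2
  open IndependentPair S₀ indS₀ ∣S₀∣≡2

  H : Adj (suc m)
  H = compl (adj G)

  forward : AlphaCritical (adj G) × W (adj G) p → MaximalTriangleFree H × p ≤ minDegree H
  forward (critical , Wp) = αCritical⇒maximalTriangleFree critical , ≤minDegree H (W⇒≤degree Wp)

  backward : MaximalTriangleFree H × p ≤ minDegree H → AlphaCritical (adj G) × W (adj G) p
  backward (maximal , p≤δ) =
    maximalTriangleFree⇒αCritical maximal ,
    degree≥⇒W 1≤p (λ v → ≤-trans p≤δ (minDegree≤degree H v)) zero

  consequences : AlphaCritical (adj G) × W (adj G) p →
                 WellCovered (adj G) × IsW (adj G) (minDegree H)
  consequences critical×Wp =
    wellCovered (λ v → ≤-trans 1≤δ (minDegree≤degree H v)) zero ,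
    1≤δ , degree≥⇒W 1≤δ (minDegree≤degree H) zero , λ q _ Wq → ≤minDegree H (W⇒≤degree Wq)
    where
    1≤δ : 1 ≤ minDegree H
    1≤δ = ≤-trans 1≤p (proj₂ (forward critical×Wp))
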